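{- Let $c\ge 0$ be an integer and let $w$ be a $c$-balanced binary word. If there exists a positive integer $n$ such that $1^n$ is not a factor of $w$, then the word $z=1^{nc}w$ is prefix normal.
   Context: Binary words are indexed from $1$; $P_w(i)$ is the number of $1$s in the prefix of length $i$ of $w$. A (finite or infinite) binary word $w$ is $c$-balanced if for any two factors $u,v$ of $w$ with $|u|=|v|$, the numbers of $1$s in $u$ and $v$ differ by at most $c$. A binary word $z$ is prefix normal if for every $i\ge1$ (with $i\le|z|$ if $z$ is finite) every factor of $z$ of length $i$ has at most $P_z(i)$ ones. -}

module Defs where

open import Data.Bool using (Bool; true; false)
open import Data.Nat using (ℕ; zero; suc; _+_; _*_; _∸_; _≤_; _<_; _<ᵇ_; ∣_-_∣)
open import Data.List using (List; []; _∷_; _++_; length; take; replicate)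
open import Data.Product using (Σ; ∃; _×_; _,_)
open import Relation.Binary.PropositionalEquality using (_≡_)

-- Finite binary words: List Bool (true = 1, false = 0).
-- Infinite binary words: ℕ → Bool, where w k is the letter at position k+1.
Word : Set
Word = List Bool

InfWord : Set
InfWord = ℕ → Bool

ones : Word → ℕ
ones []          = 0
ones (true ∷ u)  = suc (ones u)
ones (false ∷ u) = ones u

slice : InfWord → ℕ → ℕ → Word
slice w i zero    = []
slice w i (suc m) = w i ∷ slice w (suc i) m

Factor : Word → Word → Set
Factor u w = Σ Word λ p → Σ Word λ s → p ++ (u ++ s) ≡ w

FactorInf : Word → InfWord → Set
FactorInf u w = ∃ λ i → slice w i (length u) ≡ u

P : Word → ℕ → ℕ
P w i = ones (take i w)

PInf : InfWord → ℕ → ℕ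
PInf w i = ones (slice w 0 i)

Balanced : ℕ → Word → Set
Balanced c w = ∀ u v → Factor u w → Factor v w → length u ≡ length v →
  ∣ ones u - ones v ∣ ≤ c

BalancedInf : ℕ → InfWord → Set
BalancedInf c w = ∀ u v → FactorInf u w → FactorInf v w → length u ≡ length v →
  ∣ ones u - ones v ∣ ≤ c

PrefixNormal : Word → Set
PrefixNormal z = ∀ i → 1 ≤ i → i ≤ length z → ∀ u → Factor u z → length u ≡ i →
  ones u ≤ P z i

PrefixNormalInf : InfWord → Set
PrefixNormalInf z = ∀ i → 1 ≤ i → ∀ u → FactorInf u z → length u ≡ i →
  ones u ≤ PInf z i

prependOnes : ℕ → InfWord → InfWord
prependOnes zero    x i       = x i
prependOnes (suc k) x zero    = true
prependOnes (suc k) x (suc i) = prependOnes k x i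

-- Factors of z of length at most nc are harmless, as z starts with nc ones,
-- and P_z(nc + j) = nc + P_w(j); so let u be a factor of length nc + j. If u lies in w, split
-- it as u₁u₂ with |u₁| = nc: u₁ is a concatenation of c blocks of length n, each containing a 0,
-- so it has at most nc − c ones, while by c-balance u₂ has at most P_w(j) + c ones. Otherwise
-- u = 1^a t with a ≤ nc and t a prefix of w; then t has P_w(j) ones among its first j letters
-- and at most nc − a after them. Prefix normality of an infinite word is checked on its finite
-- prefixes, which are again of the form 1^(nc) w′ with w′ balanced and free of 1^n.
module Submission where

open import Defs
open import Data.Bool using (Bool; true; false)
open import Data.Nat using (ℕ; zero; suc; _+_; _*_; _∸_; _≤_; _<_; z≤n; s≤s; _≤?_; ∣_-_∣)
open import Data.Nat.Properties
open import Algebra.Properties.CommutativeSemigroup +-commutativeSemigroup using (xy∙z≈y∙zx; x∙yz≈zx∙y; x∙yz≈xz∙y)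
open import Data.List using ([]; _∷_; _++_; replicate; length; take; drop)
open import Data.List.Properties
  using (++-assoc; ++-identityʳ; length-++; length-++-≤ˡ; length-++-≤ʳ; length-replicate; length-take; take++drop≡id; ∷-injective)
open import Data.Product using (_×_; Σ; ∃₂; _,_; proj₂)
open import Data.Sum using (_⊎_; inj₁; inj₂)
open import Data.Empty using (⊥-elim)
open import Relation.Nullary using (¬_; yes; no)
open import Relation.Binary.PropositionalEquality
open import Function using (_∘_)

ones-++ : ∀ (xs ys : Word) → ones (xs ++ ys) ≡ ones xs + ones ys
ones-++ []           ys = refl
ones-++ (true ∷ xs)  ys = cong suc (ones-++ xs ys)
ones-++ (false ∷ xs) ys = ones-++ xs ys

ones≤length : ∀ (xs : Word) → ones xs ≤ length xs
ones≤length []           = z≤n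
ones≤length (true ∷ xs)  = s≤s (ones≤length xs)
ones≤length (false ∷ xs) = m≤n⇒m≤1+n (ones≤length xs)

ones-replicate : ∀ k → ones (replicate k true) ≡ k
ones-replicate zero    = refl
ones-replicate (suc k) = cong suc (ones-replicate k)

ones≡length⇒replicate : ∀ (xs : Word) → ones xs ≡ length xs → xs ≡ replicate (length xs) true
ones≡length⇒replicate []           _  = refl
ones≡length⇒replicate (true ∷ xs)  eq = cong (true ∷_) (ones≡length⇒replicate xs (suc-injective eq))
ones≡length⇒replicate (false ∷ xs) eq = ⊥-elim (1+n≰n (≤-trans (≤-reflexive (sym eq)) (ones≤length xs)))

ones-suffix-replicate : ∀ k (p m : Word) → p ++ m ≡ replicate k true → ones m ≡ length m
ones-suffix-replicate k       []      m refl = trans (ones-replicate k) (sym (length-replicate k))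
ones-suffix-replicate (suc k) (_ ∷ p) m eq   = ones-suffix-replicate k p m (proj₂ (∷-injective eq))

length-++≡replicate : ∀ {k} {b : Bool} (p m : Word) → p ++ m ≡ replicate k b → length p + length m ≡ k
length-++≡replicate {k} p m pm≡ = trans (sym (length-++ p)) (trans (cong length pm≡) (length-replicate k))

++-split-length : ∀ j {k} (t : Word) → length t ≡ j + k →
  ∃₂ λ t₁ t₂ → t ≡ t₁ ++ t₂ × length t₁ ≡ j × length t₂ ≡ k
++-split-length zero    t       eq = [] , t , refl , refl , eq
++-split-length (suc j) (x ∷ t) eq with ++-split-length j t (suc-injective eq)
... | t₁ , t₂ , refl , refl , eq₂ = x ∷ t₁ , t₂ , refl , refl , eq₂

++≡++⇒overlap : ∀ (p q r t : Word) → p ++ q ≡ r ++ t →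
  (Σ Word λ m → r ≡ p ++ m × q ≡ m ++ t) ⊎ (Σ Word λ m → p ≡ r ++ m × t ≡ m ++ q)
++≡++⇒overlap []      q r       t eq = inj₁ (r , refl , eq)
++≡++⇒overlap (x ∷ p) q []      t eq = inj₂ (x ∷ p , refl , sym eq)
++≡++⇒overlap (x ∷ p) q (y ∷ r) t eq with ∷-injective eq
... | refl , eq′ with ++≡++⇒overlap p q r t eq′
...   | inj₁ (m , refl , eq₂) = inj₁ (m , refl , eq₂)
...   | inj₂ (m , refl , eq₂) = inj₂ (m , refl , eq₂)

take-length-++ : ∀ (xs ys : Word) → take (length xs) (xs ++ ys) ≡ xs
take-length-++ []       ys = refl
take-length-++ (x ∷ xs) ys = cong (x ∷_) (take-length-++ xs ys)

take-++-≤ : ∀ i (xs ys : Word) → i ≤ length xs → take i (xs ++ ys) ≡ take i xs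
take-++-≤ zero    xs       ys _         = refl
take-++-≤ (suc i) (x ∷ xs) ys (s≤s i≤) = cong (x ∷_) (take-++-≤ i xs ys i≤)

take-replicate-++ : ∀ i k (w : Word) → i ≤ k → take i (replicate k true ++ w) ≡ replicate i true
take-replicate-++ zero    k       w _         = refl
take-replicate-++ (suc i) (suc k) w (s≤s i≤) = cong (true ∷_) (take-replicate-++ i k w i≤)

P-replicate-++ : ∀ k j (w : Word) → P (replicate k true ++ w) (k + j) ≡ k + P w j
P-replicate-++ zero    j w = refl
P-replicate-++ (suc k) j w = cong suc (P-replicate-++ k j w)

Factor-trans : ∀ {u v w : Word} → Factor u v → Factor v w → Factor u w
Factor-trans {u} {v} {w} (p , s , refl) (p′ , s′ , refl) = p′ ++ p , s ++ s′ , (begin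
  (p′ ++ p) ++ (u ++ (s ++ s′))  ≡⟨ ++-assoc p′ p _ ⟩
  p′ ++ (p ++ (u ++ (s ++ s′)))  ≡⟨ cong (λ x → p′ ++ (p ++ x)) (sym (++-assoc u s s′)) ⟩
  p′ ++ (p ++ ((u ++ s) ++ s′))  ≡⟨ cong (p′ ++_) (sym (++-assoc p (u ++ s) s′)) ⟩
  p′ ++ ((p ++ (u ++ s)) ++ s′)  ∎)
  where open ≡-Reasoning

Factor-++ˡ : ∀ (xs ys : Word) → Factor xs (xs ++ ys)
Factor-++ˡ xs ys = [] , ys , refl

Factor-++ʳ : ∀ (xs ys : Word) → Factor ys (xs ++ ys)
Factor-++ʳ xs ys = xs , [] , cong (xs ++_) (++-identityʳ ys)

Factor⇒length≤ : ∀ {u w : Word} → Factor u w → length u ≤ length w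
Factor⇒length≤ {u} (p , s , refl) = ≤-trans (length-++-≤ˡ u) (length-++-≤ʳ (u ++ s) {p})

RunFree : ℕ → Word → Set
RunFree n w = ∀ x → Factor x w → length x ≡ n → ones x < n

¬Factor-replicate⇒RunFree : ∀ n (w : Word) → ¬ Factor (replicate n true) w → RunFree n w
¬Factor-replicate⇒RunFree n w ¬run x x∈w refl with suc (ones x) ≤? length x
... | yes lt = lt
... | no ¬lt = ⊥-elim (¬run (subst (λ y → Factor y w) all-ones x∈w))
  where
  all-ones : x ≡ replicate (length x) true
  all-ones = ones≡length⇒replicate x (≤-antisym (ones≤length x) (≮⇒≥ ¬lt))

RunFree-Factor : ∀ {n} {v w : Word} → Factor v w → RunFree n w → RunFree n v
RunFree-Factor v∈w rf x x∈v = rf x (Factor-trans x∈v v∈w)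

RunFree⇒ones+c≤length : ∀ {n} c (v : Word) → RunFree n v → length v ≡ c * n → ones v + c ≤ c * n
RunFree⇒ones+c≤length zero    [] _ _ = z≤n
RunFree⇒ones+c≤length {n} (suc c) v rf ∣v∣ with ++-split-length n v ∣v∣
... | v₁ , v₂ , refl , ∣v₁∣ , ∣v₂∣ = begin
  ones (v₁ ++ v₂) + suc c        ≡⟨ cong (_+ suc c) (ones-++ v₁ v₂) ⟩
  ones v₁ + ones v₂ + suc c      ≡⟨ +-suc (ones v₁ + ones v₂) c ⟩
  suc (ones v₁ + ones v₂ + c)    ≡⟨ cong suc (+-assoc (ones v₁) (ones v₂) c) ⟩
  suc (ones v₁) + (ones v₂ + c)  ≤⟨ +-mono-≤ (rf v₁ (Factor-++ˡ v₁ v₂) ∣v₁∣) rest ⟩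
  n + c * n                      ∎
  where
  open ≤-Reasoning
  rest : ones v₂ + c ≤ c * n
  rest = RunFree⇒ones+c≤length c v₂ (RunFree-Factor (Factor-++ʳ v₁ v₂) rf) ∣v₂∣

ones-factor-≤ : ∀ {c n j} {u w : Word} → Balanced c w → RunFree n w → Factor u w →
  length u ≡ n * c + j → ones u ≤ n * c + P w j
ones-factor-≤ {c} {n} {j} {u} {w} bal rf u∈w ∣u∣ with ++-split-length (n * c) u ∣u∣
... | u₁ , u₂ , refl , ∣u₁∣ , ∣u₂∣ = begin
  ones (u₁ ++ u₂)          ≡⟨ ones-++ u₁ u₂ ⟩
  ones u₁ + ones u₂        ≤⟨ +-monoʳ-≤ (ones u₁) balance ⟩
  ones u₁ + (P w j + c)    ≡⟨ x∙yz≈xz∙y (ones u₁) (P w j) c ⟩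
  ones u₁ + c + P w j      ≤⟨ +-monoˡ-≤ (P w j) blocks ⟩
  n * c + P w j            ∎
  where
  open ≤-Reasoning
  j≤∣w∣ : j ≤ length w
  j≤∣w∣ = ≤-trans (m≤n+m j (n * c)) (≤-trans (≤-reflexive (sym ∣u∣)) (Factor⇒length≤ u∈w))
  prefix∈w : Factor (take j w) w
  prefix∈w = [] , drop j w , take++drop≡id j w
  ∣prefix∣ : length (take j w) ≡ j
  ∣prefix∣ = trans (length-take j w) (m≤n⇒m⊓n≡m j≤∣w∣)
  balance : ones u₂ ≤ P w j + c
  balance = ≤-trans (m≤n+∣m-n∣ (ones u₂) (P w j)) (+-monoʳ-≤ (P w j)
    (bal u₂ (take j w) (Factor-trans (Factor-++ʳ u₁ u₂) u∈w) prefix∈w (trans ∣u₂∣ (sym ∣prefix∣))))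
  blocks : ones u₁ + c ≤ n * c
  blocks = subst (ones u₁ + c ≤_) (*-comm c n)
    (RunFree⇒ones+c≤length c u₁ (RunFree-Factor (Factor-trans (Factor-++ˡ u₁ u₂) u∈w) rf)
      (trans ∣u₁∣ (*-comm n c)))

ones-straddling-≤ : ∀ {k j} (p m t s : Word) → p ++ m ≡ replicate k true →
  length (m ++ t) ≡ k + j → ones (m ++ t) ≤ k + P (t ++ s) j
ones-straddling-≤ {k} {j} p m t s pm≡ ∣mt∣ with ++-split-length j t ∣t∣
  where
  ∣t∣ : length t ≡ j + length p
  ∣t∣ = +-cancelˡ-≡ (length m) _ _ (begin
    length m + length t             ≡⟨ length-++ m ⟨
    length (m ++ t)                 ≡⟨ ∣mt∣ ⟩
    k + j                           ≡⟨ cong (_+ j) (length-++≡replicate p m pm≡) ⟨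
    length p + length m + j         ≡⟨ xy∙z≈y∙zx (length p) (length m) j ⟩
    length m + (j + length p)       ∎)
    where open ≡-Reasoning
... | t₁ , t₂ , refl , refl , ∣t₂∣ = begin
  ones (m ++ (t₁ ++ t₂))             ≡⟨ ones-++ m _ ⟩
  ones m + ones (t₁ ++ t₂)           ≡⟨ cong₂ _+_ (ones-suffix-replicate k p m pm≡) (ones-++ t₁ t₂) ⟩
  length m + (ones t₁ + ones t₂)     ≤⟨ +-monoʳ-≤ (length m) (+-monoʳ-≤ (ones t₁) (ones≤length t₂)) ⟩
  length m + (ones t₁ + length t₂)   ≡⟨ cong (λ x → length m + (ones t₁ + x)) ∣t₂∣ ⟩
  length m + (ones t₁ + length p)    ≡⟨ x∙yz≈zx∙y (length m) (ones t₁) (length p) ⟩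
  length p + length m + ones t₁      ≡⟨ cong (_+ ones t₁) (length-++≡replicate p m pm≡) ⟩
  k + ones t₁                        ≡⟨ cong (λ x → k + ones x) prefix ⟨
  k + P ((t₁ ++ t₂) ++ s) (length t₁) ∎
  where
  open ≤-Reasoning
  prefix : take (length t₁) ((t₁ ++ t₂) ++ s) ≡ t₁
  prefix = trans (cong (take (length t₁)) (++-assoc t₁ t₂ s)) (take-length-++ t₁ (t₂ ++ s))

ones-factor-replicate-++-≤ : ∀ {c n j} {u w : Word} → Balanced c w → RunFree n w →
  Factor u (replicate (n * c) true ++ w) → length u ≡ n * c + j → ones u ≤ n * c + P w j
ones-factor-replicate-++-≤ {c} {n} {j} {u} {w} bal rf (p , s , eq) ∣u∣
  with ++≡++⇒overlap p (u ++ s) (replicate (n * c) true) w eq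
... | inj₂ (m , _ , w≡) = ones-factor-≤ bal rf (m , s , sym w≡) ∣u∣
... | inj₁ (m , pm≡ , eq′) with ++≡++⇒overlap u s m w eq′
...   | inj₂ (t , refl , refl) = ones-straddling-≤ p m t s (sym pm≡) ∣u∣
...   | inj₁ (t , refl , _) = begin
  ones u                           ≤⟨ ones≤length u ⟩
  length u                         ≤⟨ Factor⇒length≤ (p , t , sym pm≡) ⟩
  length (replicate (n * c) true)  ≡⟨ length-replicate (n * c) ⟩
  n * c                            ≤⟨ m≤m+n (n * c) (P w j) ⟩
  n * c + P w j                    ∎
  where open ≤-Reasoning

prefixNormal-replicate-++ : ∀ c n (w : Word) → Balanced c w → ¬ Factor (replicate n true) w →
  PrefixNormal (replicate (n * c) true ++ w)
prefixNormal-replicate-++ c n w bal ¬run i _ _ u u∈z refl with length u ≤? n * c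
... | yes i≤nc = begin
  ones u                                      ≤⟨ ones≤length u ⟩
  length u                                    ≡⟨ ones-replicate (length u) ⟨
  ones (replicate (length u) true)            ≡⟨ cong ones (take-replicate-++ (length u) (n * c) w i≤nc) ⟨
  P (replicate (n * c) true ++ w) (length u)  ∎
  where open ≤-Reasoning
... | no i≰nc = subst (ones u ≤_) P≡ (ones-factor-replicate-++-≤ bal (¬Factor-replicate⇒RunFree n w ¬run) u∈z ∣u∣)
  where
  j = length u ∸ n * c
  ∣u∣ : length u ≡ n * c + j
  ∣u∣ = sym (m+[n∸m]≡n (≰⇒≥ i≰nc))
  P≡ : n * c + P w j ≡ P (replicate (n * c) true ++ w) (length u)
  P≡ = trans (sym (P-replicate-++ (n * c) j w)) (cong (P (replicate (n * c) true ++ w)) (sym ∣u∣))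

length-slice : ∀ (f : InfWord) i N → length (slice f i N) ≡ N
length-slice f i zero    = refl
length-slice f i (suc N) = cong suc (length-slice f (suc i) N)

slice-+ : ∀ (f : InfWord) i m k → slice f i (m + k) ≡ slice f i m ++ slice f (i + m) k
slice-+ f i zero    k = cong (λ x → slice f x k) (sym (+-identityʳ i))
slice-+ f i (suc m) k = cong (f i ∷_) (trans (slice-+ f (suc i) m k)
  (cong (λ x → slice f (suc i) m ++ slice f x k) (sym (+-suc i m))))

take-slice : ∀ (f : InfWord) i m k → take m (slice f i (m + k)) ≡ slice f i m
take-slice f i m k = begin
  take m (slice f i (m + k))                         ≡⟨ cong (take m) (slice-+ f i m k) ⟩
  take m (slice f i m ++ rest)                       ≡⟨ cong (λ x → take x (slice f i m ++ rest)) (length-slice f i m) ⟨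
  take (length (slice f i m)) (slice f i m ++ rest)  ≡⟨ take-length-++ (slice f i m) rest ⟩
  slice f i m                                        ∎
  where
  open ≡-Reasoning
  rest = slice f (i + m) k

slice-prependOnes : ∀ k (w : InfWord) N → slice (prependOnes k w) 0 (k + N) ≡ replicate k true ++ slice w 0 N
slice-prependOnes zero    w N = refl
slice-prependOnes (suc k) w N = cong (true ∷_) (trans (slice-suc-prependOnes (k + N)) (slice-prependOnes k w N))
  where
  slice-suc-prependOnes : ∀ {i} M → slice (prependOnes (suc k) w) (suc i) M ≡ slice (prependOnes k w) i M
  slice-suc-prependOnes zero    = refl
  slice-suc-prependOnes (suc M) = cong (_ ∷_) (slice-suc-prependOnes M)

Factor-slice⇒FactorInf : ∀ {f : InfWord} {u : Word} i N → Factor u (slice f i N) → FactorInf u f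
Factor-slice⇒FactorInf {f} {u} i N ([] , s , eq) = i , (begin
  slice f i (length u)                               ≡⟨ take-slice f i (length u) (length s) ⟨
  take (length u) (slice f i (length u + length s))  ≡⟨ cong (λ x → take (length u) (slice f i x)) ∣us∣ ⟩
  take (length u) (slice f i N)                      ≡⟨ cong (take (length u)) eq ⟨
  take (length u) (u ++ s)                           ≡⟨ take-length-++ u s ⟩
  u                                                  ∎)
  where
  open ≡-Reasoning
  ∣us∣ : length u + length s ≡ N
  ∣us∣ = trans (sym (length-++ u)) (trans (cong length eq) (length-slice f i N))
Factor-slice⇒FactorInf i (suc N) (_ ∷ p , s , eq) = Factor-slice⇒FactorInf (suc i) N (p , s , proj₂ (∷-injective eq))

PrefixNormal-++⁻ˡ : ∀ (x y : Word) → PrefixNormal (x ++ y) → PrefixNormal x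
PrefixNormal-++⁻ˡ x y pn i 1≤i i≤∣x∣ u u∈x ∣u∣ =
  subst (ones u ≤_) (cong ones (take-++-≤ i x y i≤∣x∣))
    (pn i 1≤i (≤-trans i≤∣x∣ (length-++-≤ˡ x)) u (Factor-trans u∈x (Factor-++ˡ x y)) ∣u∣)

PrefixNormalInf-from-slices : ∀ (z : InfWord) → (∀ N → PrefixNormal (slice z 0 N)) → PrefixNormalInf z
PrefixNormalInf-from-slices z pn _ 1≤i u (a , e) refl = subst (λ v → ones v ≤ PInf z L) e
  (subst (ones (slice z a L) ≤_) P≡ (pn (a + L) L 1≤i L≤ (slice z a L) u∈z′ (length-slice z a L)))
  where
  L = length u
  L≤ : L ≤ length (slice z 0 (a + L))
  L≤ = ≤-trans (m≤n+m L a) (≤-reflexive (sym (length-slice z 0 (a + L))))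
  u∈z′ : Factor (slice z a L) (slice z 0 (a + L))
  u∈z′ = subst (Factor (slice z a L)) (sym (slice-+ z 0 a L)) (Factor-++ʳ (slice z 0 a) (slice z a L))
  P≡ : P (slice z 0 (a + L)) L ≡ PInf z L
  P≡ = cong ones (trans (cong (λ N → take L (slice z 0 N)) (+-comm a L)) (take-slice z 0 L a))

prefixNormalInf-prependOnes : ∀ c n (w : InfWord) → BalancedInf c w → ¬ FactorInf (replicate n true) w →
  PrefixNormalInf (prependOnes (n * c) w)
prefixNormalInf-prependOnes c n w bal ¬run = PrefixNormalInf-from-slices z λ N →
  PrefixNormal-++⁻ˡ (slice z 0 N) (slice z N K) (subst PrefixNormal (slice-+ z 0 N K) (longer N))
  where
  K = n * c
  z = prependOnes K w
  longer : ∀ N → PrefixNormal (slice z 0 (N + K))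
  longer N = subst PrefixNormal (trans (sym (slice-prependOnes K w N)) (cong (slice z 0) (+-comm K N)))
    (prefixNormal-replicate-++ c n (slice w 0 N) balanced (¬run ∘ Factor-slice⇒FactorInf 0 N))
    where
    balanced : Balanced c (slice w 0 N)
    balanced u v u∈w v∈w = bal u v (Factor-slice⇒FactorInf 0 N u∈w) (Factor-slice⇒FactorInf 0 N v∈w)

lemma7 : (∀ (c : ℕ) (w : Word) (n : ℕ) → Balanced c w → 1 ≤ n →
              ¬ Factor (replicate n true) w →
              PrefixNormal (replicate (n * c) true ++ w))
         × (∀ (c : ℕ) (w : InfWord) (n : ℕ) → BalancedInf c w → 1 ≤ n →
              ¬ FactorInf (replicate n true) w →
              PrefixNormalInf (prependOnes (n * c) w))
lemma7 = (λ c w n bal _ ¬run → prefixNormal-replicate-++ c n w bal ¬run)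
       , (λ c w n bal _ ¬run → prefixNormalInf-prependOnes c n w bal ¬run)
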